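{- Let $k$ be a nonnegative integer and let $G$ be a finite simple graph such that every topological minor of $G$ has a vertex of degree at most $k$. Then $G$ is dynamically $(k+3)$-colorable.
   Context: A graph $H$ is a topological minor of $G$ if $G$ has a subgraph isomorphic to a subdivision of $H$. Given a proper vertex coloring of a graph, a vertex $v$ is happy if either $v$ has at most one neighbor or $v$ has two neighbors receiving distinct colors. A dynamic $m$-coloring is a proper vertex coloring with at most $m$ colors in which every vertex is happy; a graph is dynamically $m$-colorable if it has one. -}

module Defs where

open import Data.Nat using (ℕ; zero; suc; _+_; _≤_)
open import Data.Fin using (Fin; zero; suc; _≟_)
open import Data.Bool using (Bool; true; false; _∧_; _∨_; not; if_then_else_)
open import Data.List using (List; map; allFin)
open import Data.Nat.ListAction using (sum)
open import Data.Product using (Σ; ∃; _×_; _,_)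
open import Data.Sum using (_⊎_)
open import Relation.Nullary using (¬_)
open import Relation.Nullary.Decidable using (⌊_⌋)
open import Relation.Binary.PropositionalEquality using (_≡_; _≢_)
open import Function.Definitions using (Injective)

record Graph : Set where
  field
    n     : ℕ
    adj   : Fin n → Fin n → Bool
    sym   : ∀ u v → adj u v ≡ adj v u
    irrefl : ∀ v → adj v v ≡ false
open Graph public

Adj : ℕ → Set
Adj p = Fin p → Fin p → Bool

degree : (G : Graph) → Fin (n G) → ℕ
degree G v = sum (map (λ u → if adj G v u then 1 else 0) (allFin (n G)))

-- Subdividing the edge uv of a graph with adjacency S on Fin p:
-- the new vertex is 'zero', old vertex x becomes 'suc x';
-- the edge uv is deleted and edges u–new, new–v are added.
subdivide : ∀ {p} → Adj p → Fin p → Fin p → Adj (suc p)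
subdivide S u v zero    zero    = false
subdivide S u v zero    (suc y) = ⌊ y ≟ u ⌋ ∨ ⌊ y ≟ v ⌋
subdivide S u v (suc x) zero    = ⌊ x ≟ u ⌋ ∨ ⌊ x ≟ v ⌋
subdivide S u v (suc x) (suc y) =
  S x y ∧ not ((⌊ x ≟ u ⌋ ∧ ⌊ y ≟ v ⌋) ∨ (⌊ x ≟ v ⌋ ∧ ⌊ y ≟ u ⌋))

data Subdivision (H : Graph) : (p : ℕ) → Adj p → Set where
  base : Subdivision H (n H) (adj H)
  step : ∀ {p S u v} → Subdivision H p S → S u v ≡ true →
         Subdivision H (suc p) (subdivide S u v)

HasSubgraphIso : (G : Graph) → ∀ {p} → Adj p → Set
HasSubgraphIso G {p} S =
  Σ (Fin p → Fin (n G)) λ f →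
    Injective _≡_ _≡_ f × (∀ x y → S x y ≡ true → adj G (f x) (f y) ≡ true)

TopMinor : Graph → Graph → Set
TopMinor H G = Σ ℕ λ p → Σ (Adj p) λ S → Subdivision H p S × HasSubgraphIso G S

Proper : (G : Graph) → ∀ {m} → (Fin (n G) → Fin m) → Set
Proper G c = ∀ u v → adj G u v ≡ true → c u ≢ c v

Happy : (G : Graph) → ∀ {m} → (Fin (n G) → Fin m) → Fin (n G) → Set
Happy G c v =
  degree G v ≤ 1 ⊎
  (Σ (Fin (n G)) λ u → Σ (Fin (n G)) λ w →
     adj G v u ≡ true × adj G v w ≡ true × c u ≢ c w)

DynamicallyColorable : Graph → ℕ → Set
DynamicallyColorable G m =
  Σ (Fin (n G) → Fin m) λ c → Proper G c × (∀ v → Happy G c v)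

-- Induction on the number of vertices. Let v have minimum degree δ; the
-- hypothesis applied to G itself gives δ ≤ k.
--  * δ ≤ 1: colour G − v by induction and give v a colour different from that
--    of its neighbour y (if any) and, when y has at most one neighbour in G − v,
--    from that neighbour's colour.
--  * δ ≥ 2: choose neighbours a ≠ b of v and let G-s be G − v plus the edge ab,
--    a topological minor of G. Colour G-s by induction and give v a colour
--    avoiding its δ neighbours and one further neighbour of each of a and b.
--    Then v is happy through a and b, a and b are happy through v, and any other
--    vertex unhappy in G would be a neighbour of v of degree at least 3 keeping
--    two neighbours in G-s, which is impossible.

module Submission where

open import Defs renaming (sym to adj-sym)
open import Data.Nat using (ℕ; zero; suc; _+_; _≤_; _<_; z≤n; s≤s; _≤?_)
open import Data.Nat.Properties using (≤-trans; <⇒≱; +-suc; +-monoˡ-≤; m⊓n≤m)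
open import Data.Nat.ListAction using (sum)
open import Data.List.Extrema.Nat using (argmin; f[argmin]≤f[xs])
open import Data.Fin using (Fin; zero; suc; _≟_; punchIn; punchOut)
open import Data.Fin.Properties
  using (any?; injective⇒≤; punchIn-injective; punchInᵢ≢i; punchIn-punchOut; punchOut-punchIn; punchOut-cong)
open import Data.Bool using (Bool; true; false; T; if_then_else_; _∧_; _∨_; not)
open import Data.Bool.Properties using (∧-conicalˡ; ∧-conicalʳ; ∨-zeroˡ; ∨-zeroʳ; ∨-comm; ∧-comm; ¬-not)
  renaming (_≟_ to _≟ᵇ_)
open import Data.List using (List; []; _∷_; length; map; allFin; filterᵇ; lookup; take; _++_)
open import Data.List.Properties using (length-map; length-++; length-tabulate; length-take)
open import Data.List.Relation.Unary.Any using (here; there; index)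
open import Data.List.Relation.Unary.All as All using (All; []; _∷_)
open import Data.List.Relation.Unary.All.Properties using () renaming (map⁺ to All-map⁺)
open import Data.List.Relation.Unary.AllPairs using ([]; _∷_)
open import Data.List.Relation.Unary.Unique.Propositional using (Unique)
import Data.List.Relation.Unary.Unique.Propositional.Properties as Unique
open import Data.List.Membership.Propositional using (_∈_; _∉_)
open import Data.List.Membership.Propositional.Properties
  using (∈-lookup; ∈-allFin; ∈-filter⁺; ∈-filter⁻; ∈-map⁺; ∈-++⁺ˡ; ∈-++⁺ʳ)
open import Data.List.Membership.Setoid.Properties using (index-injective)
open import Data.List.Membership.DecPropositional using () renaming (_∈?_ to member?)
open import Data.Product using (Σ; ∃; _×_; _,_; proj₁; proj₂)
open import Data.Sum using (_⊎_; inj₁; inj₂)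
open import Data.Empty using (⊥)
open import Relation.Nullary using (¬_; yes; no; ¬?; contradiction)
open import Relation.Nullary.Decidable using (⌊_⌋; _×-dec_; T?; decidable-stable)
open import Relation.Binary.PropositionalEquality
  using (_≡_; _≢_; refl; sym; trans; cong; cong₂; subst; setoid; module ≡-Reasoning)
open import Function using (_∘_)
open import Function.Definitions using (Injective)

lookup-injective : ∀ {A : Set} {xs : List A} → Unique xs →
                   ∀ i j → lookup xs i ≡ lookup xs j → i ≡ j
lookup-injective {xs = _ ∷ _} _          zero    zero    _  = refl
lookup-injective {xs = _ ∷ _} (x∉xs ∷ _) zero    (suc j) eq = contradiction eq (All.lookup x∉xs (∈-lookup j))
lookup-injective {xs = _ ∷ _} (x∉xs ∷ _) (suc i) zero    eq = contradiction (sym eq) (All.lookup x∉xs (∈-lookup i))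
lookup-injective {xs = _ ∷ _} (_ ∷ uniq) (suc i) (suc j) eq = cong suc (lookup-injective uniq i j eq)

-- A duplicate-free list all of whose entries occur in xs is no longer than xs:
-- sending each entry to its position in xs is injective.
unique⊆⇒length≤ : ∀ {A : Set} {xs ys : List A} → Unique ys → (∀ {y} → y ∈ ys → y ∈ xs) →
                  length ys ≤ length xs
unique⊆⇒length≤ {A} {xs} {ys} uniq ys⊆xs = injective⇒≤ {f = position} position-injective
  where
    position : Fin (length ys) → Fin (length xs)
    position i = index (ys⊆xs (∈-lookup i))
    position-injective : ∀ {i j} → position i ≡ position j → i ≡ j
    position-injective {i} {j} eq =
      lookup-injective uniq i j (index-injective (setoid A) (ys⊆xs (∈-lookup i)) (ys⊆xs (∈-lookup j)) eq)

freeColour : ∀ {m} (used : List (Fin m)) → length used < m → ∃ λ c → c ∉ used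
freeColour {m} used short with any? (λ c → ¬? (member? _≟_ c used))
... | yes unused = unused
... | no allUsed =
  contradiction (subst (_≤ length used) (length-tabulate (λ c → c)) everyColourUsed) (<⇒≱ short)
  where
    everyColourUsed : length (allFin m) ≤ length used
    everyColourUsed = unique⊆⇒length≤ (Unique.allFin⁺ m)
      (λ {c} _ → decidable-stable (member? _≟_ c used) (λ c∉ → allUsed (c , c∉)))

∉⇒≢ : ∀ {A : Set} {x y : A} {xs : List A} → x ∉ xs → y ∈ xs → x ≢ y
∉⇒≢ x∉xs y∈xs refl = x∉xs y∈xs

few-colours : ∀ {k d ℓ} → d ≤ k → ℓ ≤ d + 2 → ℓ < k + 3
few-colours {k} {d} d≤k ℓ≤d+2 = ≤-trans (s≤s ℓ≤d+2) (subst (_≤ k + 3) (+-suc d 2) (+-monoˡ-≤ 3 d≤k))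

∈-take-1 : ∀ {A : Set} {x : A} {xs : List A} → length xs ≤ 1 → x ∈ xs → x ∈ take 1 xs
∈-take-1 {xs = _ ∷ []}    _ x∈xs = x∈xs
∈-take-1 {xs = _ ∷ _ ∷ _} (s≤s ())

∈-filterᵇ : ∀ {A : Set} (p : A → Bool) {x : A} {xs : List A} → x ∈ xs → p x ≡ true → x ∈ filterᵇ p xs
∈-filterᵇ p x∈xs px = ∈-filter⁺ (T? ∘ p) x∈xs (subst T (sym px) _)

filterᵇ-sound : ∀ {A : Set} (p : A → Bool) {x : A} (xs : List A) → x ∈ filterᵇ p xs → p x ≡ true
filterᵇ-sound p {x} xs x∈ with p x | proj₂ (∈-filter⁻ (T? ∘ p) {xs = xs} x∈)
... | true | _ = refl

neighbours : (G : Graph) → Fin (n G) → List (Fin (n G))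
neighbours G v = filterᵇ (adj G v) (allFin (n G))

indicator-sum : ∀ {A : Set} (p : A → Bool) (xs : List A) →
                sum (map (λ x → if p x then 1 else 0) xs) ≡ length (filterᵇ p xs)
indicator-sum p []       = refl
indicator-sum p (x ∷ xs) with p x
... | true  = cong suc (indicator-sum p xs)
... | false = indicator-sum p xs

degree≡length : (G : Graph) (v : Fin (n G)) → degree G v ≡ length (neighbours G v)
degree≡length G v = indicator-sum (adj G v) (allFin (n G))

∈-neighbours : (G : Graph) {v u : Fin (n G)} → adj G v u ≡ true → u ∈ neighbours G v
∈-neighbours G {v} {u} = ∈-filterᵇ (adj G v) (∈-allFin u)

neighbours-unique : (G : Graph) (v : Fin (n G)) → Unique (neighbours G v)
neighbours-unique G v = Unique.filter⁺ (T? ∘ adj G v) (Unique.allFin⁺ (n G))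

distinct-neighbours⇒≤degree : (G : Graph) {v : Fin (n G)} {us : List (Fin (n G))} →
  Unique us → All (λ u → adj G v u ≡ true) us → length us ≤ degree G v
distinct-neighbours⇒≤degree G {v} uniq adjacent =
  subst (_ ≤_) (sym (degree≡length G v))
        (unique⊆⇒length≤ uniq (∈-neighbours G ∘ All.lookup adjacent))

record NeighbourPair (G : Graph) (v : Fin (n G)) : Set where
  constructor neighbourPair
  field
    first second : Fin (n G)
    first-adj    : adj G v first ≡ true
    second-adj   : adj G v second ≡ true
    distinct     : first ≢ second

pair⇒¬degree≤1 : (G : Graph) {v : Fin (n G)} → NeighbourPair G v → ¬ degree G v ≤ 1
pair⇒¬degree≤1 G (neighbourPair u w v~u v~w u≢w) low =
  <⇒≱ (s≤s low) (distinct-neighbours⇒≤degree G ((u≢w ∷ []) ∷ [] ∷ []) (v~u ∷ v~w ∷ []))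

three-neighbours⇒3≤degree : (G : Graph) {v a b c : Fin (n G)} →
  adj G v a ≡ true → adj G v b ≡ true → adj G v c ≡ true →
  a ≢ b → a ≢ c → b ≢ c → 3 ≤ degree G v
three-neighbours⇒3≤degree G v~a v~b v~c a≢b a≢c b≢c =
  distinct-neighbours⇒≤degree G ((a≢b ∷ a≢c ∷ []) ∷ (b≢c ∷ []) ∷ [] ∷ []) (v~a ∷ v~b ∷ v~c ∷ [])

¬degree≤1⇒pair : (G : Graph) (v : Fin (n G)) → ¬ degree G v ≤ 1 → NeighbourPair G v
¬degree≤1⇒pair G v high =
  pick (neighbours G v) (neighbours-unique G v) (filterᵇ-sound (adj G v) (allFin (n G)))
       (high ∘ subst (_≤ 1) (sym (degree≡length G v)))
  where
    pick : (us : List (Fin (n G))) → Unique us → (∀ {u} → u ∈ us → adj G v u ≡ true) →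
           ¬ length us ≤ 1 → NeighbourPair G v
    pick []          _                 _        short = contradiction z≤n short
    pick (_ ∷ [])    _                 _        short = contradiction (s≤s z≤n) short
    pick (u ∷ w ∷ _) ((u≢w ∷ _) ∷ _) adjacent _     =
      neighbourPair u w (adjacent (here refl)) (adjacent (there (here refl))) u≢w

degree≤1-unique : (G : Graph) {v a b : Fin (n G)} → degree G v ≤ 1 →
  adj G v a ≡ true → adj G v b ≡ true → a ≡ b
degree≤1-unique G {a = a} {b} low v~a v~b with a ≟ b
... | yes a≡b = a≡b
... | no a≢b  = contradiction low (pair⇒¬degree≤1 G (neighbourPair a b v~a v~b a≢b))

neighbour-besides : (G : Graph) (v : Fin (n G)) → ¬ degree G v ≤ 1 →
  ∀ z → Σ (Fin (n G)) λ w → adj G v w ≡ true × w ≢ z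
neighbour-besides G v high z with ¬degree≤1⇒pair G v high
... | neighbourPair u w v~u v~w u≢w with u ≟ z
...   | yes refl = w , v~w , u≢w ∘ sym
...   | no u≢z   = u , v~u , u≢z

pair-besides : (G : Graph) (v : Fin (n G)) → 3 ≤ degree G v → ∀ z →
  Σ (NeighbourPair G v) λ p → NeighbourPair.first p ≢ z × NeighbourPair.second p ≢ z
pair-besides G v many z =
  pick (neighbours G v) (neighbours-unique G v) (filterᵇ-sound (adj G v) (allFin (n G)))
       (subst (3 ≤_) (degree≡length G v) many)
  where
    pick : (us : List (Fin (n G))) → Unique us → (∀ {u} → u ∈ us → adj G v u ≡ true) →
           3 ≤ length us → Σ (NeighbourPair G v) λ p → NeighbourPair.first p ≢ z × NeighbourPair.second p ≢ z
    pick (_ ∷ [])        _ _ (s≤s ())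
    pick (_ ∷ _ ∷ [])    _ _ (s≤s (s≤s ()))
    pick (a ∷ b ∷ c ∷ _) ((a≢b ∷ a≢c ∷ _) ∷ (b≢c ∷ _) ∷ _) adjacent _ with a ≟ z | b ≟ z
    ... | yes refl | _        = neighbourPair b c v~b v~c b≢c , a≢b ∘ sym , a≢c ∘ sym
      where v~b = adjacent (there (here refl)); v~c = adjacent (there (there (here refl)))
    ... | no a≢z   | yes refl = neighbourPair a c v~a v~c a≢c , a≢z , b≢c ∘ sym
      where v~a = adjacent (here refl); v~c = adjacent (there (there (here refl)))
    ... | no a≢z   | no b≢z   = neighbourPair a b v~a v~b a≢b , a≢z , b≢z
      where v~a = adjacent (here refl); v~b = adjacent (there (here refl))

MinorDegenerate : ℕ → Graph → Set
MinorDegenerate k G = (H : Graph) → TopMinor H G → Σ ℕ (λ m → n H ≡ suc m) →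
                      Σ (Fin (n H)) (λ v → degree H v ≤ k)

TopMinor-refl : (G : Graph) → TopMinor G G
TopMinor-refl G = n G , adj G , base , (λ x → x) , (λ eq → eq) , (λ _ _ e → e)

compose-embeddings : (G G' : Graph) {p : ℕ} {S : Adj p} →
  HasSubgraphIso G (adj G') → HasSubgraphIso G' S → HasSubgraphIso G S
compose-embeddings G G' (f , f-inj , f-hom) (g , g-inj , g-hom) =
  f ∘ g , g-inj ∘ f-inj , λ x y e → f-hom (g x) (g y) (g-hom x y e)

subgraph-TopMinor : (G G' : Graph) → HasSubgraphIso G (adj G') → ∀ H → TopMinor H G' → TopMinor H G
subgraph-TopMinor G G' embed H (p , S , subdiv , embed') =
  p , S , subdiv , compose-embeddings G G' embed embed'

MinorDegenerate-inherit : ∀ {k} {G G' : Graph} → (∀ H → TopMinor H G' → TopMinor H G) →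
  MinorDegenerate k G → MinorDegenerate k G'
MinorDegenerate-inherit minor degenerate H = degenerate H ∘ minor H

SameEdge : ∀ {A : Set} → A → A → A → A → Set
SameEdge u w x y = (x ≡ u × y ≡ w) ⊎ (x ≡ w × y ≡ u)

-- The Boolean test for SameEdge, verbatim as in the definition of 'subdivide'.
isEdge : ∀ {p} → Fin p → Fin p → Fin p → Fin p → Bool
isEdge u w x y = (⌊ x ≟ u ⌋ ∧ ⌊ y ≟ w ⌋) ∨ (⌊ x ≟ w ⌋ ∧ ⌊ y ≟ u ⌋)

≟-sound : ∀ {p} {x y : Fin p} → ⌊ x ≟ y ⌋ ≡ true → x ≡ y
≟-sound {x = x} {y} holds with x ≟ y
... | yes x≡y = x≡y

≟-refl : ∀ {p} (x : Fin p) → ⌊ x ≟ x ⌋ ≡ true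
≟-refl x with x ≟ x
... | yes _   = refl
... | no x≢x = contradiction refl x≢x

∨-true : ∀ {a b} → a ∨ b ≡ true → a ≡ true ⊎ b ≡ true
∨-true {true}  _      = inj₁ refl
∨-true {false} b≡true = inj₂ b≡true

not-true : ∀ {a} → not a ≡ true → a ≢ true
not-true {true} () refl

∧-true : ∀ {a b} → a ∧ b ≡ true → a ≡ true × b ≡ true
∧-true {a} {b} holds = ∧-conicalˡ a b holds , ∧-conicalʳ a b holds

isEdge-sound : ∀ {p} (u w x y : Fin p) → isEdge u w x y ≡ true → SameEdge u w x y
isEdge-sound u w x y holds with ∨-true holds
... | inj₁ forward  = inj₁ (≟-sound (proj₁ (∧-true forward)) , ≟-sound (proj₂ (∧-true forward)))
... | inj₂ backward = inj₂ (≟-sound (proj₁ (∧-true backward)) , ≟-sound (proj₂ (∧-true backward)))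

isEdge-complete : ∀ {p} (u w x y : Fin p) → SameEdge u w x y → isEdge u w x y ≡ true
isEdge-complete u w _ _ (inj₁ (refl , refl))
  rewrite ≟-refl u | ≟-refl w = refl
isEdge-complete u w _ _ (inj₂ (refl , refl))
  rewrite ≟-refl u | ≟-refl w = ∨-zeroʳ _

isEdge-sym : ∀ {p} (u w x y : Fin p) → isEdge u w x y ≡ isEdge u w y x
isEdge-sym u w x y = begin
  (⌊ x ≟ u ⌋ ∧ ⌊ y ≟ w ⌋) ∨ (⌊ x ≟ w ⌋ ∧ ⌊ y ≟ u ⌋) ≡⟨ ∨-comm (⌊ x ≟ u ⌋ ∧ ⌊ y ≟ w ⌋) _ ⟩
  (⌊ x ≟ w ⌋ ∧ ⌊ y ≟ u ⌋) ∨ (⌊ x ≟ u ⌋ ∧ ⌊ y ≟ w ⌋) ≡⟨ cong₂ _∨_ (∧-comm ⌊ x ≟ w ⌋ _) (∧-comm ⌊ x ≟ u ⌋ _) ⟩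
  (⌊ y ≟ u ⌋ ∧ ⌊ x ≟ w ⌋) ∨ (⌊ y ≟ w ⌋ ∧ ⌊ x ≟ u ⌋) ∎
  where open ≡-Reasoning

isEdge-irrefl : ∀ {p} {u w : Fin p} → u ≢ w → ∀ x → isEdge u w x x ≡ false
isEdge-irrefl {u = u} {w} u≢w x = ¬-not λ loop → u≢w (endpoints (isEdge-sound u w x x loop))
  where
    endpoints : SameEdge u w x x → u ≡ w
    endpoints (inj₁ (refl , refl)) = refl
    endpoints (inj₂ (refl , refl)) = refl

-- The Boolean test "y ∈ {u, w}" attaching the new vertex in 'subdivide'.
isEnd-sound : ∀ {p} {u w y : Fin p} → (⌊ y ≟ u ⌋ ∨ ⌊ y ≟ w ⌋) ≡ true → y ≡ u ⊎ y ≡ w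
isEnd-sound holds with ∨-true holds
... | inj₁ y≡u = inj₁ (≟-sound y≡u)
... | inj₂ y≡w = inj₂ (≟-sound y≡w)

SameEdge-ends : ∀ {A : Set} {u w x y : A} → SameEdge u w x y → (x ≡ u ⊎ x ≡ w) × (y ≡ u ⊎ y ≡ w)
SameEdge-ends (inj₁ (x≡u , y≡w)) = inj₁ x≡u , inj₂ y≡w
SameEdge-ends (inj₂ (x≡w , y≡u)) = inj₂ x≡w , inj₁ y≡u

SameEdge-injective : ∀ {A B : Set} {f : A → B} → Injective _≡_ _≡_ f → ∀ {u w x₀ y₀ x y} →
  SameEdge u w (f x₀) (f y₀) → SameEdge u w (f x) (f y) → SameEdge x₀ y₀ x y
SameEdge-injective f-inj (inj₁ (p , q)) (inj₁ (r , s)) = inj₁ (f-inj (trans r (sym p)) , f-inj (trans s (sym q)))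
SameEdge-injective f-inj (inj₁ (p , q)) (inj₂ (r , s)) = inj₂ (f-inj (trans r (sym q)) , f-inj (trans s (sym p)))
SameEdge-injective f-inj (inj₂ (p , q)) (inj₁ (r , s)) = inj₂ (f-inj (trans r (sym q)) , f-inj (trans s (sym p)))
SameEdge-injective f-inj (inj₂ (p , q)) (inj₂ (r , s)) = inj₁ (f-inj (trans r (sym p)) , f-inj (trans s (sym q)))

-- G is a graph on Fin (suc N) and v one of its vertices; the other
-- vertices are identified with Fin N through 'old = punchIn v'.
module AtVertex {N : ℕ} (A : Adj (suc N)) (A-sym : ∀ u w → A u w ≡ A w u)
                (A-irrefl : ∀ u → A u u ≡ false) (v : Fin (suc N)) where

  G : Graph
  G = record { n = suc N ; adj = A ; sym = A-sym ; irrefl = A-irrefl }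

  no-loop : ∀ u → A u u ≢ true
  no-loop u loop = contradiction (trans (sym loop) (A-irrefl u)) λ ()

  old : Fin N → Fin (suc N)
  old = punchIn v

  old-injective : Injective _≡_ _≡_ old
  old-injective = punchIn-injective v _ _

  old≢v : ∀ x → old x ≢ v
  old≢v = punchInᵢ≢i v

  data Vertex : Fin (suc N) → Set where
    is-v   : Vertex v
    is-old : (x : Fin N) → Vertex (old x)

  vertex : ∀ u → Vertex u
  vertex u with v ≟ u
  ... | yes refl = is-v
  ... | no v≢u   = subst Vertex (punchIn-punchOut v≢u) (is-old (punchOut v≢u))

  G-v : Graph
  G-v = record { n = N ; adj = λ x y → A (old x) (old y)
               ; sym = λ x y → A-sym (old x) (old y) ; irrefl = A-irrefl ∘ old }

  G-v⊆G : HasSubgraphIso G (adj G-v)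
  G-v⊆G = old , old-injective , λ _ _ x~y → x~y

  extend : ∀ {m} → Fin m → (Fin N → Fin m) → Fin (suc N) → Fin m
  extend col c u with v ≟ u
  ... | yes _    = col
  ... | no v≢u   = c (punchOut v≢u)

  module Extension {m : ℕ} (col : Fin m) (c : Fin N → Fin m) where

    extend-v : extend col c v ≡ col
    extend-v with v ≟ v
    ... | yes _   = refl
    ... | no v≢v = contradiction refl v≢v

    extend-old : ∀ x → extend col c (old x) ≡ c x
    extend-old x with v ≟ old x
    ... | yes v≡old = contradiction (sym v≡old) (old≢v x)
    ... | no v≢old  = cong c (trans (punchOut-cong v refl) (punchOut-punchIn v))

    happy-old : ∀ x p q → A (old x) (old p) ≡ true → A (old x) (old q) ≡ true → c p ≢ c q →
                Happy G (extend col c) (old x)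
    happy-old x p q x~p x~q cp≢cq = inj₂ (old p , old q , x~p , x~q ,
      λ same → cp≢cq (trans (sym (extend-old p)) (trans same (extend-old q))))

    happy-via-v : ∀ x z → A (old x) v ≡ true → A (old x) (old z) ≡ true → col ≢ c z →
                  Happy G (extend col c) (old x)
    happy-via-v x z x~v x~z col≢cz = inj₂ (v , old z , x~v , x~z ,
      λ same → col≢cz (trans (sym extend-v) (trans same (extend-old z))))

    extend-dynamic : Proper G-v c → (∀ y → A v (old y) ≡ true → col ≢ c y) →
      Happy G (extend col c) v → (∀ x → Happy G (extend col c) (old x)) →
      DynamicallyColorable G m
    extend-dynamic c-proper col-fresh v-happy old-happy = extend col c , proper , happy
      where
        proper : Proper G (extend col c)
        proper u w u~w with vertex u | vertex w
        ... | is-v     | is-v     = contradiction u~w (no-loop v)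
        ... | is-v     | is-old y = λ same → col-fresh y u~w (trans (sym extend-v) (trans same (extend-old y)))
        ... | is-old x | is-v     = λ same →
          col-fresh x (trans (A-sym v (old x)) u~w) (trans (sym extend-v) (trans (sym same) (extend-old x)))
        ... | is-old x | is-old y = λ same →
          c-proper x y u~w (trans (sym (extend-old x)) (trans same (extend-old y)))

        happy : ∀ u → Happy G (extend col c) u
        happy u with vertex u
        ... | is-v     = v-happy
        ... | is-old x = old-happy x

  v-neighbour-old : ∀ {u} → A v u ≡ true → Σ (Fin N) λ y → old y ≡ u
  v-neighbour-old {u} v~u with vertex u
  ... | is-v     = contradiction v~u (no-loop v)
  ... | is-old y = y , refl

  old-neighbour : ∀ x → ¬ degree G (old x) ≤ 1 → Σ (Fin N) λ z → A (old x) (old z) ≡ true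
  old-neighbour x high with neighbour-besides G (old x) high v
  ... | w , x~w , w≢v with vertex w
  ...   | is-v     = contradiction refl w≢v
  ...   | is-old z = z , x~w

  module Supergraph (A' : Adj N) (A'-sym : ∀ x y → A' x y ≡ A' y x) (A'-irrefl : ∀ x → A' x x ≡ false)
                    (G-v⊆G' : ∀ x y → A (old x) (old y) ≡ true → A' x y ≡ true) where

    G' : Graph
    G' = record { n = N ; adj = A' ; sym = A'-sym ; irrefl = A'-irrefl }

    -- An old vertex of degree at most one in G' which gained both v and
    -- another neighbour in G: the only way happiness in G' can fail to lift.
    record Late (x : Fin N) : Set where
      constructor late
      field
        v-adjacent     : A (old x) v ≡ true
        low            : degree G' x ≤ 1
        other          : Fin N
        other-adjacent : A (old x) (old other) ≡ true

    lift-happy : ∀ {m} (col : Fin m) (c : Fin N → Fin m) x →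
      (∀ y → A' x y ≡ true → A (old x) (old y) ≡ true) →
      Happy G' c x → Happy G (extend col c) (old x) ⊎ Late x
    lift-happy col c x G'⊆G (inj₂ (p , q , x~p , x~q , cp≢cq)) =
      inj₁ (Extension.happy-old col c x p q (G'⊆G p x~p) (G'⊆G q x~q) cp≢cq)
    lift-happy col c x _ (inj₁ low) with degree G (old x) ≤? 1
    ... | yes low-in-G = inj₁ (inj₁ low-in-G)
    ... | no high with ¬degree≤1⇒pair G (old x) high
    ...   | neighbourPair u w x~u x~w u≢w with vertex u | vertex w
    ...     | is-v     | is-v     = contradiction refl u≢w
    ...     | is-v     | is-old z = inj₂ (late x~u low z x~w)
    ...     | is-old z | is-v     = inj₂ (late x~w low z x~u)
    ...     | is-old p | is-old q = contradiction low (pair⇒¬degree≤1 G'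
                (neighbourPair p q (G-v⊆G' x p x~u) (G-v⊆G' x q x~w) (u≢w ∘ cong old)))

  v-neighbours : List (Fin N)
  v-neighbours = filterᵇ (A v ∘ old) (allFin N)

  -- They are distinct neighbours of v, so there are at most degree G v of them.
  length-v-neighbours : length v-neighbours ≤ degree G v
  length-v-neighbours = subst (_≤ degree G v) (length-map old v-neighbours)
    (distinct-neighbours⇒≤degree G
      (Unique.map⁺ old-injective (Unique.filter⁺ (T? ∘ A v ∘ old) (Unique.allFin⁺ N)))
      (All-map⁺ (All.tabulate (filterᵇ-sound (A v ∘ old) (allFin N)))))

  fresh-at-v : ∀ {m} {col : Fin m} {c : Fin N → Fin m} extra → col ∉ map c v-neighbours ++ extra →
               ∀ y → A v (old y) ≡ true → col ≢ c y
  fresh-at-v {c = c} extra col∉ y v~y =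
    ∉⇒≢ col∉ (∈-++⁺ˡ (∈-map⁺ c (∈-filterᵇ (A v ∘ old) (∈-allFin y) v~y)))

  module Deletion = Supergraph (adj G-v) (adj-sym G-v) (irrefl G-v) (λ _ _ x~y → x~y)

  extend-from-G-v : ∀ {m} (col : Fin m) (c : Fin N → Fin m) → Proper G-v c → (∀ x → Happy G-v c x) →
    (∀ y → A v (old y) ≡ true → col ≢ c y) → Happy G (extend col c) v →
    (∀ x → Deletion.Late x → Happy G (extend col c) (old x)) → DynamicallyColorable G m
  extend-from-G-v col c c-proper c-happy col-fresh v-happy late-happy =
    Extension.extend-dynamic col c c-proper col-fresh v-happy old-happy
    where
      old-happy : ∀ x → Happy G (extend col c) (old x)
      old-happy x with Deletion.lift-happy col c x (λ _ x~y → x~y) (c-happy x)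
      ... | inj₁ happy = happy
      ... | inj₂ x-late = late-happy x x-late

  isolated-case : ∀ {m} (col : Fin m) → degree G v ≤ 1 → (∀ y → A v (old y) ≢ true) →
    DynamicallyColorable G-v m → DynamicallyColorable G m
  isolated-case col low no-neighbour (c , c-proper , c-happy) =
    extend-from-G-v col c c-proper c-happy (λ y v~y → contradiction v~y (no-neighbour y)) (inj₁ low)
      (λ x x-late → contradiction (trans (A-sym v (old x)) (Deletion.Late.v-adjacent x-late))
                                  (no-neighbour x))

  pendant-case : ∀ {m} (col : Fin m) (c : Fin N → Fin m) {y : Fin N} →
    degree G v ≤ 1 → A v (old y) ≡ true → Proper G-v c → (∀ x → Happy G-v c x) → col ≢ c y →
    (∀ z → A (old y) (old z) ≡ true → degree G-v y ≤ 1 → col ≢ c z) → DynamicallyColorable G m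
  pendant-case col c {y} low v~y c-proper c-happy col≢cy col≢partner =
    extend-from-G-v col c c-proper c-happy col-fresh (inj₁ low) late-happy
    where
      the-neighbour : ∀ {x} → A v (old x) ≡ true → x ≡ y
      the-neighbour v~x = old-injective (degree≤1-unique G low v~x v~y)

      col-fresh : ∀ x → A v (old x) ≡ true → col ≢ c x
      col-fresh x v~x with the-neighbour v~x
      ... | refl = col≢cy

      late-happy : ∀ x → Deletion.Late x → Happy G (extend col c) (old x)
      late-happy x (Deletion.late x~v low-x z x~z) with the-neighbour (trans (A-sym v (old x)) x~v)
      ... | refl = Extension.happy-via-v col c x z x~v x~z (col≢partner z x~z low-x)

  -- Deletion step: if v has degree at most one, a dynamic (k+3)-colouring of G − v
  -- extends to G, the colour of v avoiding at most two colours.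
  deletion-step : ∀ k → degree G v ≤ 1 → DynamicallyColorable G-v (k + 3) → DynamicallyColorable G (k + 3)
  deletion-step k low colouring with any? (λ y → A v (old y) ≟ᵇ true)
  ... | no isolated = isolated-case (proj₁ (freeColour [] (few-colours z≤n z≤n))) low
                        (λ y v~y → isolated (y , v~y)) colouring
  deletion-step k low (c , c-proper , c-happy) | yes (y , v~y) =
    pendant-case col c low v~y c-proper c-happy (col∉ ∘ here) partner-fresh
    where
      partners : List (Fin N)
      partners = take 1 (neighbours G-v y)

      avoided : List (Fin (k + 3))
      avoided = c y ∷ map c partners

      length-avoided : length avoided ≤ 0 + 2
      length-avoided = s≤s (subst (_≤ 1)
        (sym (trans (length-map c partners) (length-take 1 (neighbours G-v y))))
        (m⊓n≤m 1 (length (neighbours G-v y))))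

      col : Fin (k + 3)
      col = proj₁ (freeColour avoided (few-colours z≤n length-avoided))

      col∉ : col ∉ avoided
      col∉ = proj₂ (freeColour avoided (few-colours z≤n length-avoided))

      partner-fresh : ∀ z → A (old y) (old z) ≡ true → degree G-v y ≤ 1 → col ≢ c z
      partner-fresh z y~z low-y = ∉⇒≢ col∉ (there (∈-map⁺ c
        (∈-take-1 (subst (_≤ 1) (degree≡length G-v y) low-y) (∈-neighbours G-v y~z))))

  module Suppression {a b : Fin N} (a≢b : a ≢ b) (v~a : A v (old a) ≡ true) (v~b : A v (old b) ≡ true) where

    A-s : Adj N
    A-s x y = A (old x) (old y) ∨ isEdge a b x y

    G-v⊆G-s : ∀ x y → A (old x) (old y) ≡ true → A-s x y ≡ true
    G-v⊆G-s x y x~y = trans (cong (_∨ isEdge a b x y) x~y) (∨-zeroˡ (isEdge a b x y))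

    open Supergraph A-s (λ x y → cong₂ _∨_ (A-sym (old x) (old y)) (isEdge-sym a b x y))
                        (λ x → cong₂ _∨_ (A-irrefl (old x)) (isEdge-irrefl a≢b x)) G-v⊆G-s
      renaming (G' to G-s) public

    a~b : A-s a b ≡ true
    a~b = trans (cong (A (old a) (old b) ∨_) (isEdge-complete a b a b (inj₁ (refl , refl)))) (∨-zeroʳ _)

    G-s-edge : ∀ {x y} → A-s x y ≡ true → A (old x) (old y) ≡ true ⊎ SameEdge a b x y
    G-s-edge {x} {y} x~y with ∨-true x~y
    ... | inj₁ edge = inj₁ edge
    ... | inj₂ ab   = inj₂ (isEdge-sound a b x y ab)

    v~ab : ∀ {u} → u ≡ a ⊎ u ≡ b → A v (old u) ≡ true
    v~ab (inj₁ refl) = v~a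
    v~ab (inj₂ refl) = v~b

    -- G-s is a topological minor of G: a subdivision embedded in G-s either avoids
    -- the edge ab, and then lies in G − v, or uses it for exactly one of its edges,
    -- and then subdividing that edge once more and routing it through v embeds it in G.
    suppression-minor : ∀ H → TopMinor H G-s → TopMinor H G
    suppression-minor H (p , S , S-subdivision , f , f-inj , f-hom)
      with any? (λ x → any? (λ y → (S x y ≟ᵇ true) ×-dec (isEdge a b (f x) (f y) ≟ᵇ true)))
    ... | no avoids-ab = subgraph-TopMinor G G-v G-v⊆G H (p , S , S-subdivision , f , f-inj , f-hom′)
      where
        f-hom′ : ∀ x y → S x y ≡ true → A (old (f x)) (old (f y)) ≡ true
        f-hom′ x y x~y with G-s-edge (f-hom x y x~y)
        ... | inj₁ edge = edge
        ... | inj₂ ab   = contradiction (x , y , x~y , isEdge-complete a b (f x) (f y) ab) avoids-ab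
    ... | yes (x₀ , y₀ , x₀~y₀ , onto-ab) =
      suc p , subdivide S x₀ y₀ , step S-subdivision x₀~y₀ , g , g-injective , g-hom
      where
        onto : SameEdge a b (f x₀) (f y₀)
        onto = isEdge-sound a b (f x₀) (f y₀) onto-ab

        g : Fin (suc p) → Fin (suc N)
        g zero    = v
        g (suc x) = old (f x)

        g-injective : ∀ {x y} → g x ≡ g y → x ≡ y
        g-injective {zero}  {zero}  _     = refl
        g-injective {zero}  {suc y} v≡old = contradiction (sym v≡old) (old≢v (f y))
        g-injective {suc x} {zero}  old≡v = contradiction old≡v (old≢v (f x))
        g-injective {suc x} {suc y} same  = cong suc (f-inj (old-injective same))

        v~end : ∀ y → y ≡ x₀ ⊎ y ≡ y₀ → A v (old (f y)) ≡ true
        v~end y (inj₁ refl) = v~ab (proj₁ (SameEdge-ends onto))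
        v~end y (inj₂ refl) = v~ab (proj₂ (SameEdge-ends onto))

        g-hom : ∀ x y → subdivide S x₀ y₀ x y ≡ true → A (g x) (g y) ≡ true
        g-hom zero    (suc y) y-end = v~end y (isEnd-sound y-end)
        g-hom (suc x) zero    x-end = trans (A-sym (old (f x)) v) (v~end x (isEnd-sound x-end))
        g-hom (suc x) (suc y) x~y with ∧-true x~y
        ... | S-edge , not-x₀y₀ with G-s-edge (f-hom x y S-edge)
        ...   | inj₁ edge = edge
        ...   | inj₂ ab   = contradiction
                  (isEdge-complete x₀ y₀ x y (SameEdge-injective f-inj onto ab)) (not-true not-x₀y₀)

    G-s-edge-away : ∀ x → x ≢ a → x ≢ b → ∀ y → A-s x y ≡ true → A (old x) (old y) ≡ true
    G-s-edge-away x x≢a x≢b y x~y with G-s-edge x~y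
    ... | inj₁ edge = edge
    ... | inj₂ ab with proj₁ (SameEdge-ends ab)
    ...   | inj₁ x≡a = contradiction x≡a x≢a
    ...   | inj₂ x≡b = contradiction x≡b x≢b

    -- If v has minimum degree, no vertex other than a and b is late: it would be
    -- a third neighbour of v, so it has two old neighbours, which survive in G-s.
    no-late : (∀ u → degree G v ≤ degree G u) → ∀ x → x ≢ a → x ≢ b → ¬ Late x
    no-late minimum x x≢a x≢b (late x~v low _ _) =
      keeps-two (pair-besides G (old x) (≤-trans v-degree≥3 (minimum (old x))) v)
      where
        v-degree≥3 : 3 ≤ degree G v
        v-degree≥3 = three-neighbours⇒3≤degree G (trans (A-sym v (old x)) x~v) v~a v~b
                       (x≢a ∘ old-injective) (x≢b ∘ old-injective) (a≢b ∘ old-injective)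

        keeps-two : Σ (NeighbourPair G (old x)) (λ p → NeighbourPair.first p ≢ v × NeighbourPair.second p ≢ v) → ⊥
        keeps-two (neighbourPair u w x~u x~w u≢w , u≢v , w≢v) with vertex u | vertex w
        ... | is-v     | _        = u≢v refl
        ... | is-old _ | is-v     = w≢v refl
        ... | is-old p | is-old q = pair⇒¬degree≤1 G-s
              (neighbourPair p q (G-v⊆G-s x p x~u) (G-v⊆G-s x q x~w) (u≢w ∘ cong old)) low

    -- If v has minimum degree, a dynamic colouring c of G-s extends to G once the
    -- colour of v avoids the colours of v's neighbours and of one old neighbour
    -- each of a and b: a and b become happy through v and that neighbour.
    suppression-case : ∀ {m} (col : Fin m) (c : Fin N → Fin m) → (∀ u → degree G v ≤ degree G u) →
      Proper G-s c → (∀ x → Happy G-s c x) → (∀ y → A v (old y) ≡ true → col ≢ c y) →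
      ∀ {za zb} → A (old a) (old za) ≡ true → A (old b) (old zb) ≡ true → col ≢ c za → col ≢ c zb →
      DynamicallyColorable G m
    suppression-case col c minimum c-proper c-happy col-fresh {za} {zb} a~za b~zb col≢cza col≢czb =
      extend-dynamic (λ x y x~y → c-proper x y (G-v⊆G-s x y x~y)) col-fresh v-happy old-happy
      where
        open Extension col c

        v-happy : Happy G (extend col c) v
        v-happy = inj₂ (old a , old b , v~a , v~b , λ same →
          c-proper a b a~b (trans (sym (extend-old a)) (trans same (extend-old b))))

        old-happy : ∀ x → Happy G (extend col c) (old x)
        old-happy x with x ≟ a | x ≟ b
        ... | yes refl | _        = happy-via-v a za (trans (A-sym (old a) v) v~a) a~za col≢cza
        ... | no _     | yes refl = happy-via-v b zb (trans (A-sym (old b) v) v~b) b~zb col≢czb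
        ... | no x≢a   | no x≢b with lift-happy col c x (G-s-edge-away x x≢a x≢b) (c-happy x)
        ...   | inj₁ happy  = happy
        ...   | inj₂ x-late = contradiction x-late (no-late minimum x x≢a x≢b)

    -- Suppression step: if v has minimum degree δ ≤ k, a dynamic (k+3)-colouring of
    -- G-s extends to G, the colour of v avoiding at most δ + 2 colours.
    suppression-step : ∀ k → (∀ u → degree G v ≤ degree G u) → degree G v ≤ k →
      DynamicallyColorable G-s (k + 3) → DynamicallyColorable G (k + 3)
    suppression-step k minimum δ≤k (c , c-proper , c-happy) =
      suppression-case col c minimum c-proper c-happy (fresh-at-v _ col∉) a~za b~zb
        (∉⇒≢ col∉ (∈-++⁺ʳ (map c v-neighbours) (here refl)))
        (∉⇒≢ col∉ (∈-++⁺ʳ (map c v-neighbours) (there (here refl))))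
      where
        -- every vertex has degree at least that of v, which has the neighbours a and b
        high-degree : ∀ u → ¬ degree G u ≤ 1
        high-degree u = pair⇒¬degree≤1 G (neighbourPair (old a) (old b) v~a v~b (a≢b ∘ old-injective))
                      ∘ ≤-trans (minimum u)

        za zb : Fin N
        za = proj₁ (old-neighbour a (high-degree (old a)))
        zb = proj₁ (old-neighbour b (high-degree (old b)))

        a~za : A (old a) (old za) ≡ true
        a~za = proj₂ (old-neighbour a (high-degree (old a)))

        b~zb : A (old b) (old zb) ≡ true
        b~zb = proj₂ (old-neighbour b (high-degree (old b)))

        avoided : List (Fin (k + 3))
        avoided = map c v-neighbours ++ c za ∷ c zb ∷ []

        length-avoided : length avoided ≤ degree G v + 2
        length-avoided = subst (_≤ degree G v + 2) (sym (length-++ (map c v-neighbours)))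
          (+-monoˡ-≤ 2 (subst (_≤ degree G v) (sym (length-map c v-neighbours)) length-v-neighbours))

        col : Fin (k + 3)
        col = proj₁ (freeColour avoided (few-colours δ≤k length-avoided))

        col∉ : col ∉ avoided
        col∉ = proj₂ (freeColour avoided (few-colours δ≤k length-avoided))

  induction-step : ∀ k → (∀ u → degree G v ≤ degree G u) → degree G v ≤ k → MinorDegenerate k G →
    ((G' : Graph) → n G' ≡ N → MinorDegenerate k G' → DynamicallyColorable G' (k + 3)) →
    DynamicallyColorable G (k + 3)
  induction-step k minimum δ≤k degenerate colour with degree G v ≤? 1
  ... | yes low = deletion-step k low
        (colour G-v refl (MinorDegenerate-inherit {G = G} {G-v} (subgraph-TopMinor G G-v G-v⊆G) degenerate))
  ... | no high with ¬degree≤1⇒pair G v high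
  ...   | neighbourPair u w v~u v~w u≢w with v-neighbour-old v~u | v-neighbour-old v~w
  ...     | a , refl | b , refl = suppression-step k minimum δ≤k
            (colour G-s refl (MinorDegenerate-inherit {G = G} {G-s} suppression-minor degenerate))
    where open Suppression (u≢w ∘ cong old) v~u v~w

minimum-degree-vertex : (G : Graph) → Fin (n G) → Σ (Fin (n G)) λ v → ∀ u → degree G v ≤ degree G u
minimum-degree-vertex G u₀ =
  argmin (degree G) u₀ (allFin (n G)) ,
  λ u → All.lookup (f[argmin]≤f[xs] u₀ (allFin (n G))) (∈-allFin u)

colourable : ∀ k N (G : Graph) → n G ≡ N → MinorDegenerate k G → DynamicallyColorable G (k + 3)
colourable k zero    G refl _          = (λ ()) , (λ ()) , (λ ())
colourable k (suc N) G refl degenerate =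
  AtVertex.induction-step (adj G) (adj-sym G) (irrefl G) v k minimum δ≤k degenerate (colourable k N)
  where
    v : Fin (suc N)
    v = proj₁ (minimum-degree-vertex G zero)

    minimum : ∀ u → degree G v ≤ degree G u
    minimum = proj₂ (minimum-degree-vertex G zero)

    -- G itself is a nonempty topological minor of G.
    δ≤k : degree G v ≤ k
    δ≤k = let u , degree-u≤k = degenerate G (TopMinor-refl G) (N , refl)
          in ≤-trans (minimum u) degree-u≤k

lemma6p2 : (k : ℕ) (G : Graph) →
    ((H : Graph) → TopMinor H G → Σ ℕ (λ m → n H ≡ suc m) →
       Σ (Fin (n H)) (λ v → degree H v ≤ k)) →
    DynamicallyColorable G (k + 3)
lemma6p2 k G = colourable k (n G) G refl
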